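{- Let $T=(V,E)$ be a rooted tree with $|V|=n$ and let $x$ be an integer with $2\le x<n$. Then there exist a subset $S\subset V$ and a vertex $v\in S$ such that $x<|S|\le 2x-1$, the induced subgraph $T|_S$ is a limb of $T$, and the induced subgraph $T|_{(V\setminus S)\cup\{v\}}$ is connected.
   Context: In a rooted tree, for a vertex $u$ and a child $c$ of $u$, the branch of $u$ at $c$ is the rooted subtree induced by $u$ together with all descendants of $c$ (including $c$), rooted at $u$. A limb of the rooted tree is the union of a vertex $u$ and some (possibly all or none) of the branches of $u$, i.e. the subgraph induced by $u$ together with the subtrees of some subset of the children of $u$. -}

module Defs where

open import Data.Nat using (ℕ; zero; suc)
open import Data.Fin using (Fin)
open import Data.Fin.Subset using (Subset; _∈_; _∉_)
open import Data.Product using (Σ; ∃; ∃-syntax; _×_; _,_)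
open import Data.Sum using (_⊎_)
open import Relation.Binary.PropositionalEquality using (_≡_; _≢_)
open import Relation.Binary.Construct.Closure.ReflexiveTransitive using (Star)

iter : {A : Set} → (A → A) → ℕ → A → A
iter f zero    a = a
iter f (suc k) a = f (iter f k a)

-- The root is its own parent (a dummy value; it has no parent edge), and
-- every vertex reaches the root by iterating the parent map.  The edges are
-- exactly {u , parent u} for u ≢ root.
record RootedTree (n : ℕ) : Set where
  field
    root       : Fin n
    parent     : Fin n → Fin n
    parent-root : parent root ≡ root
    reaches    : (u : Fin n) → ∃[ k ] iter parent k u ≡ root

module _ {n : ℕ} (T : RootedTree n) where
  open RootedTree T

  Adj : Fin n → Fin n → Set
  Adj u w = (u ≢ root × parent u ≡ w) ⊎ (w ≢ root × parent w ≡ u)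

  IsChild : Fin n → Fin n → Set
  IsChild c u = c ≢ root × parent c ≡ u

  IsDesc : Fin n → Fin n → Set
  IsDesc w c = ∃[ k ] iter parent k w ≡ c

  AdjIn : Subset n → Fin n → Fin n → Set
  AdjIn A u w = u ∈ A × w ∈ A × Adj u w

  ConnectedIn : Subset n → Set
  ConnectedIn A = (u w : Fin n) → u ∈ A → w ∈ A → Star (AdjIn A) u w

  IsLimb : Subset n → Set
  IsLimb S = Σ (Fin n) λ u → Σ (Subset n) λ C →
      ((c : Fin n) → c ∈ C → IsChild c u)
    × ((w : Fin n) → w ∈ S → (w ≡ u ⊎ Σ (Fin n) λ c → c ∈ C × IsDesc w c))
    × ((w : Fin n) → (w ≡ u ⊎ Σ (Fin n) λ c → c ∈ C × IsDesc w c) → w ∈ S)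

module Submission where

-- Call a vertex heavy if its subtree has more than x vertices.  The
-- root is heavy (x < n), and subtrees shrink strictly from a vertex to its
-- children, so descending along heavy children ends at a heavy vertex u all
-- of whose children are light.  Enumerate the children of u and add their
-- branches to {u} one at a time: the limb sizes start at 1 ≤ x and end at
-- least at |subtree u| > x, so some step crosses x, going from a limb L with
-- |L| ≤ x to L ∪ subtree c.  If |subtree c| < x then this limb has at most
-- (x − 1) + x vertices; if |subtree c| = x then {u} ∪ subtree c has x + 1 ≤
-- 2x − 1 vertices.  Finally, the complement of any limb at u, plus u, is
-- closed under taking parents, hence connected through the root.

open import Defs
open import Data.Nat using (ℕ; zero; suc; _≤_; _<_; _+_; _∸_; _*_; pred; z≤n; s≤s; _<?_; _≤?_)
open import Data.Nat.Properties
  using (≤-refl; ≤-trans; <-≤-trans; n≤1+n; +-suc; +-monoʳ-≤; +-mono-<-≤; +-comm; +-identityʳ;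
         <⇒≤pred; <⇒≱; ≤-pred; ≤-reflexive; m≤m*n; ≮⇒≥; ≰⇒>; <⇒≤; m∸n+n≡m; m≤n⇒m<n∨m≡n)
open import Data.Fin using (Fin; toℕ; fromℕ; fromℕ<; _≟_)
open import Data.Fin.Properties using (any?; toℕ-fromℕ; toℕ-fromℕ<)
open import Data.Fin.Subset using (Subset; _∈_; _⊆_; _⊂_; ∣_∣; ∁; _∪_; ⁅_⁆; ⊤; inside; outside)
open import Data.Fin.Subset.Properties
  using (_∈?_; x∈p∪q⁺; x∈p∪q⁻; p⊆p∪q; q⊆p∪q; x∈⁅x⁆; x∈⁅y⁆⇒x≡y; x∈∁p⇒x∉p; x∉p⇒x∈∁p; ∣⁅x⁆∣≡1;
         ∣⊤∣≡n; p⊆q⇒∣p∣≤∣q∣; p⊂q⇒∣p∣<∣q∣)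
open import Data.Vec using ([]; _∷_; tabulate)
open import Data.Vec.Properties using (lookup∘tabulate; []=⇒lookup; lookup⇒[]=)
open import Data.List using (List; []; _∷_; filter; allFin)
open import Data.List.Relation.Unary.All using (All; []; _∷_)
import Data.List.Relation.Unary.All as All
open import Data.List.Relation.Unary.All.Properties using (all-filter)
open import Data.List.Relation.Unary.Any using (Any; here; there)
open import Data.List.Membership.Propositional using (find; lose)
open import Data.List.Membership.Propositional.Properties using (∈-filter⁺; ∈-allFin)
import Data.List.Membership.DecPropositional as DecMembership
open import Data.Product using (Σ; ∃; _×_; _,_; proj₁; proj₂)
open import Data.Sum using (_⊎_; inj₁; inj₂; map₂)
open import Data.Bool using (true)
open import Relation.Nullary using (Dec; yes; no; ¬_; does; contradiction)
open import Relation.Nullary.Decidable using (map′; dec-true; _×-dec_; ¬?)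
open import Relation.Unary using (Decidable)
open import Relation.Binary.PropositionalEquality using (_≡_; _≢_; refl; sym; trans; cong; subst)
open import Relation.Binary.Construct.Closure.ReflexiveTransitive using (Star; ε; _◅_; _◅◅_; reverse)

⟪_⟫ : {n : ℕ} {P : Fin n → Set} → Decidable P → Subset n
⟪ P? ⟫ = tabulate (λ w → does (P? w))

∈⟪⟫⁺ : {n : ℕ} {P : Fin n → Set} (P? : Decidable P) {w : Fin n} → P w → w ∈ ⟪ P? ⟫
∈⟪⟫⁺ P? {w} pw = lookup⇒[]= w _ (trans (lookup∘tabulate _ w) (dec-true (P? w) pw))

∈⟪⟫⁻ : {n : ℕ} {P : Fin n → Set} (P? : Decidable P) {w : Fin n} → w ∈ ⟪ P? ⟫ → P w
∈⟪⟫⁻ P? {w} w∈ = fromDoes (P? w) (trans (sym (lookup∘tabulate _ w)) ([]=⇒lookup w∈))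
  where
  fromDoes : {A : Set} (a? : Dec A) → does a? ≡ true → A
  fromDoes (yes a) _ = a

∣p∪q∣≤∣p∣+∣q∣ : {n : ℕ} (p q : Subset n) → ∣ p ∪ q ∣ ≤ ∣ p ∣ + ∣ q ∣
∣p∪q∣≤∣p∣+∣q∣ []            []            = z≤n
∣p∪q∣≤∣p∣+∣q∣ (outside ∷ p) (outside ∷ q) = ∣p∪q∣≤∣p∣+∣q∣ p q
∣p∪q∣≤∣p∣+∣q∣ (inside ∷ p)  (outside ∷ q) = s≤s (∣p∪q∣≤∣p∣+∣q∣ p q)
∣p∪q∣≤∣p∣+∣q∣ (outside ∷ p) (inside ∷ q)  =
  ≤-trans (s≤s (∣p∪q∣≤∣p∣+∣q∣ p q)) (≤-reflexive (sym (+-suc ∣ p ∣ ∣ q ∣)))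
∣p∪q∣≤∣p∣+∣q∣ (inside ∷ p)  (inside ∷ q)  =
  s≤s (≤-trans (∣p∪q∣≤∣p∣+∣q∣ p q) (+-monoʳ-≤ ∣ p ∣ (n≤1+n ∣ q ∣)))

+-bound : {a b x : ℕ} → a < x → b ≤ x → a + b ≤ 2 * x ∸ 1
+-bound {a} {b} {x} a<x b≤x = subst (λ m → a + b ≤ pred m) x+x≡2x (<⇒≤pred (+-mono-<-≤ a<x b≤x))
  where
  x+x≡2x : x + x ≡ 2 * x
  x+x≡2x = cong (x +_) (sym (+-identityʳ x))

crossing : {A : Set} {P : A → Set} (F : List A → ℕ) {x : ℕ} → F [] ≤ x →
  {L : List A} → All P L → x < F L →
  Σ A λ c → Σ (List A) λ L′ → P c × All P L′ × F L′ ≤ x × x < F (c ∷ L′)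
crossing F base []                     big = contradiction base (<⇒≱ big)
crossing F {x} base {c ∷ L} (pc ∷ pL) big with x <? F L
... | yes big′ = crossing F base pL big′
... | no small = c , L , pc , pL , ≮⇒≥ small , big

iter-+ : {A : Set} (f : A → A) (a b : ℕ) (w : A) → iter f (a + b) w ≡ iter f a (iter f b w)
iter-+ f zero    b w = refl
iter-+ f (suc a) b w = cong f (iter-+ f a b w)

iter-suc : {A : Set} (f : A → A) (k : ℕ) (w : A) → iter f (suc k) w ≡ iter f k (f w)
iter-suc f zero    w = refl
iter-suc f (suc k) w = cong f (iter-suc f k w)

module Tree {n : ℕ} (T : RootedTree n) where
  open RootedTree T
  open DecMembership (_≟_ {n}) using () renaming (_∈?_ to _∈ₗ?_)

  iter-root : (k : ℕ) → iter parent k root ≡ root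
  iter-root zero    = refl
  iter-root (suc k) = trans (cong parent (iter-root k)) parent-root

  stays-at-root : {w : Fin n} {k m : ℕ} → k ≤ m → iter parent k w ≡ root → iter parent m w ≡ root
  stays-at-root {w} {k} {m} k≤m at-root =
    trans (cong (λ j → iter parent j w) (sym (m∸n+n≡m k≤m)))
      (trans (iter-+ parent (m ∸ k) k w) (trans (cong (iter parent (m ∸ k)) at-root) (iter-root (m ∸ k))))

  -- The parent map has no cycle other than the loop at the root: a vertex on
  -- a cycle returns to itself after every multiple of its length, and one of
  -- these multiples is long enough to have reached the root.
  acyclic : {w : Fin n} (m : ℕ) → iter parent (suc m) w ≡ w → w ≡ root
  acyclic {w} m cycle = trans (sym (around k)) (stays-at-root (m≤m*n k (suc m)) (proj₂ (reaches w)))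
    where
    k : ℕ
    k = proj₁ (reaches w)
    around : (j : ℕ) → iter parent (j * suc m) w ≡ w
    around zero    = refl
    around (suc j) = trans (iter-+ parent (suc m) (j * suc m) w) (trans (cong (iter parent (suc m)) (around j)) cycle)

  -- Being a descendant is decidable: the walk up from w reaches the root after
  -- k steps and stays there, so only the first k + 1 steps need checking.
  desc? : (w c : Fin n) → Dec (IsDesc T w c)
  desc? w c = map′ (λ (j , e) → toℕ j , e) early (any? (λ (j : Fin (suc k)) → iter parent (toℕ j) w ≟ c))
    where
    k : ℕ
    k = proj₁ (reaches w)
    at-step : {i : ℕ} (j : Fin (suc k)) → toℕ j ≡ i → iter parent i w ≡ c → iter parent (toℕ j) w ≡ c
    at-step j refl e = e
    early : IsDesc T w c → ∃ λ (j : Fin (suc k)) → iter parent (toℕ j) w ≡ c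
    early (m , e) with m ≤? k
    ... | yes m≤k = fromℕ< (s≤s m≤k) , at-step (fromℕ< (s≤s m≤k)) (toℕ-fromℕ< (s≤s m≤k)) e
    ... | no m≰k  = fromℕ k , at-step (fromℕ k) (toℕ-fromℕ k) (trans (proj₂ (reaches w)) root≡c)
      where
      root≡c : root ≡ c
      root≡c = trans (sym (stays-at-root (<⇒≤ (≰⇒> m≰k)) (proj₂ (reaches w)))) e

  isChild? : (c u : Fin n) → Dec (IsChild T c u)
  isChild? c u = ¬? (c ≟ root) ×-dec (parent c ≟ u)

  desc-child : {w c u : Fin n} → IsDesc T w c → IsChild T c u → IsDesc T w u
  desc-child (k , e) (_ , pc) = suc k , trans (cong parent e) pc

  desc-parent : {w c : Fin n} → IsDesc T (parent w) c → IsDesc T w c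
  desc-parent {w} (k , e) = suc k , trans (iter-suc parent k w) e

  not-below-child : {c u : Fin n} → IsChild T c u → ¬ IsDesc T u c
  not-below-child {c} {u} (c≢root , pc) (k , e) =
    c≢root (trans (sym e) (trans (cong (iter parent k) u≡root) (iter-root k)))
    where
    u≡root : u ≡ root
    u≡root = acyclic k (trans (cong parent e) pc)

  -- A proper descendant of u lies in the branch of u at some child: the last
  -- vertex before u on the walk up from w.
  in-some-branch : {w u : Fin n} (k : ℕ) → iter parent k w ≡ u → w ≢ u →
    Σ (Fin n) λ c → IsChild T c u × IsDesc T w c
  in-some-branch zero e w≢u = contradiction e w≢u
  in-some-branch {w} {u} (suc k) e w≢u with iter parent k w ≟ u
  ... | yes e′  = in-some-branch k e′ w≢u
  ... | no c≢u = iter parent k w , (c≢root , e) , (k , refl)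
    where
    c≢root : iter parent k w ≢ root
    c≢root c≡root = c≢u (trans c≡root (trans (sym parent-root) (trans (cong parent (sym c≡root)) e)))

  subtree : Fin n → Subset n
  subtree c = ⟪ (λ w → desc? w c) ⟫

  size : Fin n → ℕ
  size c = ∣ subtree c ∣

  ∈subtree⁺ : {w c : Fin n} → IsDesc T w c → w ∈ subtree c
  ∈subtree⁺ {c = c} = ∈⟪⟫⁺ (λ w → desc? w c)

  ∈subtree⁻ : {w c : Fin n} → w ∈ subtree c → IsDesc T w c
  ∈subtree⁻ {c = c} = ∈⟪⟫⁻ (λ w → desc? w c)

  subtree-child⊂ : {c u : Fin n} → IsChild T c u → subtree c ⊂ subtree u
  subtree-child⊂ ch =
    (λ w∈ → ∈subtree⁺ (desc-child (∈subtree⁻ w∈) ch)) ,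
    _ , ∈subtree⁺ (0 , refl) , (λ u∈ → not-below-child ch (∈subtree⁻ u∈))

  size-root : n ≤ size root
  size-root = subst (_≤ size root) (∣⊤∣≡n n) (p⊆q⇒∣p∣≤∣q∣ {p = ⊤} (λ {w} _ → ∈subtree⁺ (reaches w)))

  ParentClosed : Subset n → Set
  ParentClosed A = (w : Fin n) → w ∈ A → w ≢ root → parent w ∈ A

  -- A parent-closed set is connected: each member climbs to the root inside it.
  parent-closed⇒connected : (A : Subset n) → ParentClosed A → ConnectedIn T A
  parent-closed⇒connected A closed a b a∈A b∈A =
    climb (proj₁ (reaches a)) a∈A (proj₂ (reaches a))
      ◅◅ reverse swap (climb (proj₁ (reaches b)) b∈A (proj₂ (reaches b)))
    where
    climb : {w : Fin n} (k : ℕ) → w ∈ A → iter parent k w ≡ root → Star (AdjIn T A) w root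
    climb zero w∈A refl = ε
    climb {w} (suc k) w∈A e with w ≟ root
    ... | yes refl    = ε
    ... | no w≢root = (w∈A , p∈A , inj₁ (w≢root , refl)) ◅ climb k p∈A (trans (sym (iter-suc parent k w)) e)
      where
      p∈A : parent w ∈ A
      p∈A = closed w w∈A w≢root
    swap : {v w : Fin n} → AdjIn T A v w → AdjIn T A w v
    swap (v∈ , w∈ , inj₁ e) = w∈ , v∈ , inj₂ e
    swap (v∈ , w∈ , inj₂ e) = w∈ , v∈ , inj₁ e

  LowestHeavy : ℕ → Fin n → Set
  LowestHeavy x u = x < size u × ((c : Fin n) → IsChild T c u → size c ≤ x)

  -- Below every heavy vertex lies a lowest heavy one: descend through heavy
  -- children; the subtree sizes decrease strictly, bounding the descent.
  lowest-heavy-below : {x : ℕ} (bound : ℕ) (u : Fin n) → size u ≤ bound → x < size u →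
    Σ (Fin n) (LowestHeavy x)
  lowest-heavy-below zero u u≤0 heavy = contradiction (≤-trans u≤0 z≤n) (<⇒≱ heavy)
  lowest-heavy-below {x} (suc bound) u u≤bound heavy with any? (λ c → isChild? c u ×-dec (x <? size c))
  ... | yes (c , ch , c-heavy) =
    lowest-heavy-below bound c (≤-pred (≤-trans (p⊂q⇒∣p∣<∣q∣ (subtree-child⊂ ch)) u≤bound)) c-heavy
  ... | no none = u , heavy , λ c ch → ≮⇒≥ (λ c-heavy → none (c , ch , c-heavy))

  -- Since x < n the root is heavy, so a lowest heavy vertex exists.
  lowest-heavy : {x : ℕ} → x < n → Σ (Fin n) (LowestHeavy x)
  lowest-heavy x<n = lowest-heavy-below (size root) root ≤-refl (<-≤-trans x<n size-root)

  Witness : ℕ → Set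
  Witness x = Σ (Subset n) λ S → Σ (Fin n) λ v →
    v ∈ S × x < ∣ S ∣ × ∣ S ∣ ≤ 2 * x ∸ 1 × IsLimb T S × ConnectedIn T (∁ S ∪ ⁅ v ⁆)

  module Limbs (u : Fin n) where

    ChildrenOfU : List (Fin n) → Set
    ChildrenOfU = All (λ c → IsChild T c u)

    limb : List (Fin n) → Subset n
    limb []      = ⁅ u ⁆
    limb (c ∷ L) = subtree c ∪ limb L

    u∈limb : (L : List (Fin n)) → u ∈ limb L
    u∈limb []      = x∈⁅x⁆ u
    u∈limb (c ∷ L) = q⊆p∪q (subtree c) (limb L) (u∈limb L)

    ∈limb⁺ : {w : Fin n} (L : List (Fin n)) → Any (IsDesc T w) L → w ∈ limb L
    ∈limb⁺ (c ∷ L) (here d)  = p⊆p∪q (limb L) (∈subtree⁺ d)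
    ∈limb⁺ (c ∷ L) (there a) = q⊆p∪q (subtree c) (limb L) (∈limb⁺ L a)

    ∈limb⁻ : {w : Fin n} (L : List (Fin n)) → w ∈ limb L → w ≡ u ⊎ Any (IsDesc T w) L
    ∈limb⁻ []      w∈ = inj₁ (x∈⁅y⁆⇒x≡y u w∈)
    ∈limb⁻ (c ∷ L) w∈ with x∈p∪q⁻ (subtree c) (limb L) w∈
    ... | inj₁ w∈c = inj₂ (here (∈subtree⁻ w∈c))
    ... | inj₂ w∈L = map₂ there (∈limb⁻ L w∈L)

    limb-isLimb : {L : List (Fin n)} → ChildrenOfU L → IsLimb T (limb L)
    limb-isLimb {L} are-children = u , chosen , chosen-children , sound , complete
      where
      chosen : Subset n
      chosen = ⟪ (λ c → c ∈ₗ? L) ⟫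
      chosen-children : (c : Fin n) → c ∈ chosen → IsChild T c u
      chosen-children c c∈ = All.lookup are-children (∈⟪⟫⁻ (λ c → c ∈ₗ? L) c∈)
      sound : (w : Fin n) → w ∈ limb L → w ≡ u ⊎ Σ (Fin n) λ c → c ∈ chosen × IsDesc T w c
      sound w w∈ = map₂ (λ a → let c , c∈L , d = find a in c , ∈⟪⟫⁺ (λ c → c ∈ₗ? L) c∈L , d) (∈limb⁻ L w∈)
      complete : (w : Fin n) → (w ≡ u ⊎ Σ (Fin n) λ c → c ∈ chosen × IsDesc T w c) → w ∈ limb L
      complete w (inj₁ refl)          = u∈limb L
      complete w (inj₂ (c , c∈ , d)) = ∈limb⁺ L (lose (∈⟪⟫⁻ (λ c → c ∈ₗ? L) c∈) d)

    -- Removing such a limb but keeping its apex u leaves a parent-closed set: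
    -- a vertex whose parent lies in a chosen branch lies in that branch too,
    -- and u itself cannot lie below one of its children.
    rest-closed : {L : List (Fin n)} → ChildrenOfU L → ParentClosed (∁ (limb L) ∪ ⁅ u ⁆)
    rest-closed {L} are-children w w∈ w≢root with parent w ∈? limb L
    ... | no p∉ = x∈p∪q⁺ (inj₁ (x∉p⇒x∈∁p p∉))
    ... | yes p∈ with ∈limb⁻ L p∈
    ...   | inj₁ p≡u = x∈p∪q⁺ (inj₂ (subst (_∈ ⁅ u ⁆) (sym p≡u) (x∈⁅x⁆ u)))
    ...   | inj₂ a with find a | x∈p∪q⁻ (∁ (limb L)) ⁅ u ⁆ w∈
    ...     | c , c∈L , d | inj₁ w∉ =
      contradiction (∈limb⁺ L (lose c∈L (desc-parent d))) (x∈∁p⇒x∉p w∉)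
    ...     | c , c∈L , d | inj₂ w∈u =
      contradiction (subst (λ v → IsDesc T v c) (x∈⁅y⁆⇒x≡y u w∈u) (desc-parent d))
        (not-below-child (All.lookup are-children c∈L))

    limb-witness : {x : ℕ} {L : List (Fin n)} → ChildrenOfU L →
      x < ∣ limb L ∣ → ∣ limb L ∣ ≤ 2 * x ∸ 1 → Witness x
    limb-witness {L = L} are-children big small =
      limb L , u , u∈limb L , big , small , limb-isLimb are-children ,
      parent-closed⇒connected (∁ (limb L) ∪ ⁅ u ⁆) (rest-closed are-children)

    children : List (Fin n)
    children = filter (λ c → isChild? c u) (allFin n)

    children-of-u : ChildrenOfU children
    children-of-u = all-filter (λ c → isChild? c u) (allFin n)

    subtree⊆full-limb : subtree u ⊆ limb children
    subtree⊆full-limb {w} w∈ with w ≟ u | ∈subtree⁻ w∈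
    ... | yes refl | _ = u∈limb children
    ... | no w≢u | k , e with in-some-branch k e w≢u
    ...   | c , ch , d = ∈limb⁺ children (lose (∈-filter⁺ (λ c → isChild? c u) (∈-allFin c) ch) d)

    apex-small : {x : ℕ} → 2 ≤ x → ∣ limb [] ∣ ≤ x
    apex-small 2≤x = subst (_≤ _) (sym (∣⁅x⁆∣≡1 u)) (≤-trans (s≤s z≤n) 2≤x)

    -- At a lowest heavy vertex, adding the branches one at a time crosses x
    -- at a limb of admissible size.  If the branch that crosses has exactly x
    -- vertices, that branch plus u is already admissible since 2 ≤ x.
    balanced-limb : {x : ℕ} → 2 ≤ x → LowestHeavy x u → Witness x
    balanced-limb {x} 2≤x (heavy , light)
      with crossing (λ L → ∣ limb L ∣) (apex-small 2≤x) children-of-u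
             (<-≤-trans heavy (p⊆q⇒∣p∣≤∣q∣ subtree⊆full-limb))
    ... | c , L , ch , chs , L-small , cL-big with m≤n⇒m<n∨m≡n (light c ch)
    ...   | inj₁ c<x = limb-witness (ch ∷ chs) cL-big
            (≤-trans (∣p∪q∣≤∣p∣+∣q∣ (subtree c) (limb L)) (+-bound c<x L-small))
    ...   | inj₂ c≡x = limb-witness (ch ∷ []) big small
      where
      big : x < ∣ limb (c ∷ []) ∣
      big = subst (_< ∣ limb (c ∷ []) ∣) c≡x (p⊂q⇒∣p∣<∣q∣
              (p⊆p∪q ⁅ u ⁆ , u , u∈limb (c ∷ []) , λ u∈ → not-below-child ch (∈subtree⁻ u∈)))
      small : ∣ limb (c ∷ []) ∣ ≤ 2 * x ∸ 1
      small = ≤-trans (∣p∪q∣≤∣p∣+∣q∣ (subtree c) ⁅ u ⁆)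
                (subst (_≤ 2 * x ∸ 1) (trans (+-comm 1 (size c)) (cong (size c +_) (sym (∣⁅x⁆∣≡1 u))))
                  (+-bound 2≤x (≤-reflexive c≡x)))

mainTheorem19 : (n : ℕ) (T : RootedTree n) (x : ℕ) → 2 ≤ x → x < n →
    Σ (Subset n) λ S → Σ (Fin n) λ v →
    v ∈ S × x < ∣ S ∣ × ∣ S ∣ ≤ 2 * x ∸ 1
    × IsLimb T S × ConnectedIn T (∁ S ∪ ⁅ v ⁆)
mainTheorem19 n T x 2≤x x<n = Limbs.balanced-limb u 2≤x u-lowest-heavy
  where
  open Tree T
  u : Fin n
  u = proj₁ (lowest-heavy x<n)
  u-lowest-heavy : LowestHeavy x u
  u-lowest-heavy = proj₂ (lowest-heavy x<n)
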